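{- For every $n\ge 1$, the prime $p_n$ is an $\mathbf{R}$-prime if and only if $\pi(p_n/2)=\pi(p_{n+1}/2)$.
   Context: $p_j$ denotes the $j$-th prime ($p_1=2$) and $\pi(x)$ the number of primes $\le x$ for real $x$. A prime $p_n$ is called an $\mathbf{R}$-prime if either $n=1$ (i.e. $p_n=2$), or $n\ge 2$ and every integer $k$ with $\frac{p_n+1}{2}\le k\le\frac{p_{n+1}-1}{2}$ is composite. (For odd $p_n$ this is equivalent to: with $p_m<p_n/2<p_{m+1}$, the open interval $(p_n,2p_{m+1})$ contains a prime.) -}

module Defs where

open import Data.Nat using (ℕ; zero; suc; _+_; _*_; _∸_; _≤_)
open import Data.Nat.Primality using (Prime; Composite; prime?)
open import Data.List using (List; filter; length; upTo)
open import Data.Product using (_×_)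
open import Data.Sum using (_⊎_)
open import Relation.Binary.PropositionalEquality using (_≡_)

-- π x = number of primes ≤ x (x a natural number).
-- For real y ≥ 0, π(y) = π(⌊y⌋); in particular π(p/2) = π(p / 2) (floor division).
π : ℕ → ℕ
π x = length (filter prime? (upTo (suc x)))

-- IsNthPrime n p  ⇔  p = p_n  (p is prime and exactly n primes are ≤ p; p_1 = 2).
IsNthPrime : ℕ → ℕ → Set
IsNthPrime n p = Prime p × π p ≡ n

-- R-prime condition for p = p_n with next prime q = p_{n+1}:
-- n = 1, or n ≥ 2 and every integer k with (p+1)/2 ≤ k ≤ (q-1)/2 is composite.
-- (p+1)/2 ≤ k ⇔ p + 1 ≤ 2k ;  k ≤ (q-1)/2 ⇔ 2k + 1 ≤ q.
IsRPrime : ℕ → ℕ → ℕ → Set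
IsRPrime n p q =
  n ≡ 1 ⊎ (2 ≤ n × (∀ k → p + 1 ≤ 2 * k → 2 * k + 1 ≤ q → Composite k))

{-# OPTIONS --safe #-}
-- π takes the same value at a ≤ b exactly when no prime lies in (a, b]. For p ≥ 2 and an odd
-- prime q, the integers k with p + 1 ≤ 2k and 2k + 1 ≤ q are exactly those in (⌊p/2⌋, ⌊q/2⌋],
-- and all of them exceed 1, so "composite" and "not prime" agree there. This settles p_n ≥ 3,
-- where n ≥ 2 and q = p_{n+1} is odd; for p_n = 2 the next prime is 3 and both sides hold.
module Submission where

open import Defs
open import Data.Nat using (ℕ; zero; suc; _+_; _*_; _≤_; _<_; _/_; z≤n; NonZero; n>1⇒nonTrivial; nonTrivial⇒n>1)
open import Data.Nat.Properties
open import Data.Nat.DivMod using (m<n*o⇒m/o<n; m*n/n≡m; m/n*n≤m; /-monoˡ-≤)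
open import Data.Nat.Divisibility using (divides)
open import Data.Nat.Primality
open import Data.List using (filter; length; upTo; _++_; [_])
open import Data.List.Properties using (upTo-∷ʳ; length-++; filter-++; filter-accept; filter-reject)
open import Data.Product using (_,_)
open import Data.Sum using (inj₁; inj₂)
open import Relation.Nullary using (¬_; contradiction; yes; no)
open import Relation.Nullary.Decidable using (toWitness)
open import Relation.Binary.PropositionalEquality using (_≡_; _≢_; refl; sym; trans; cong; subst; subst₂; module ≡-Reasoning)
open import Function.Bundles using (_⇔_; mk⇔; Equivalence)
open import Function.Properties.Equivalence using () renaming (sym to ⇔-sym; trans to ⇔-trans)

π-suc : ∀ x → π (suc x) ≡ π x + length (filter prime? [ suc x ])
π-suc x = begin
  length (filter prime? (upTo (suc (suc x))))
    ≡⟨ cong (λ xs → length (filter prime? xs)) (sym (upTo-∷ʳ (suc x))) ⟩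
  length (filter prime? (upTo (suc x) ++ [ suc x ]))
    ≡⟨ cong length (filter-++ prime? (upTo (suc x)) [ suc x ]) ⟩
  length (filter prime? (upTo (suc x)) ++ filter prime? [ suc x ])
    ≡⟨ length-++ (filter prime? (upTo (suc x))) ⟩
  π x + length (filter prime? [ suc x ]) ∎
  where open ≡-Reasoning

π-suc-prime : ∀ {x} → Prime (suc x) → π (suc x) ≡ suc (π x)
π-suc-prime {x} p = begin
  π (suc x)                              ≡⟨ π-suc x ⟩
  π x + length (filter prime? [ suc x ]) ≡⟨ cong (λ xs → π x + length xs) (filter-accept prime? p) ⟩
  π x + 1                                ≡⟨ +-comm (π x) 1 ⟩
  suc (π x)                              ∎
  where open ≡-Reasoning

π-suc-¬prime : ∀ {x} → ¬ Prime (suc x) → π (suc x) ≡ π x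
π-suc-¬prime {x} ¬p = begin
  π (suc x)                              ≡⟨ π-suc x ⟩
  π x + length (filter prime? [ suc x ]) ≡⟨ cong (λ xs → π x + length xs) (filter-reject prime? ¬p) ⟩
  π x + 0                                ≡⟨ +-identityʳ (π x) ⟩
  π x                                    ∎
  where open ≡-Reasoning

π-≤-suc : ∀ x → π x ≤ π (suc x)
π-≤-suc x with prime? (suc x)
... | yes p = ≤-trans (n≤1+n (π x)) (≤-reflexive (sym (π-suc-prime p)))
... | no ¬p = ≤-reflexive (sym (π-suc-¬prime ¬p))

π-mono : ∀ {a b} → a ≤ b → π a ≤ π b
π-mono {b = zero} z≤n = ≤-refl
π-mono {b = suc b} a≤1+b with m≤n⇒m<n∨m≡n a≤1+b
... | inj₁ a<1+b = ≤-trans (π-mono (≤-pred a<1+b)) (π-≤-suc b)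
... | inj₂ refl  = ≤-refl

π-<-prime : ∀ {a k b} → Prime k → a < k → k ≤ b → π a < π b
π-<-prime {a} {suc k} {b} p a<k k≤b = begin-strict
  π a       ≤⟨ π-mono (≤-pred a<k) ⟩
  π k       <⟨ ≤-reflexive (sym (π-suc-prime p)) ⟩
  π (suc k) ≤⟨ π-mono k≤b ⟩
  π b       ∎
  where open ≤-Reasoning

π-<⇒< : ∀ {a b} → π a < π b → a < b
π-<⇒< πa<πb = ≰⇒> λ b≤a → <⇒≱ πa<πb (π-mono b≤a)

NoPrimeIn : ℕ → ℕ → Set
NoPrimeIn a b = ∀ k → a < k → k ≤ b → ¬ Prime k

noPrimeIn⇒π-≡ : ∀ {a b} → a ≤ b → NoPrimeIn a b → π a ≡ π b
noPrimeIn⇒π-≡ {b = zero} z≤n _ = refl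
noPrimeIn⇒π-≡ {b = suc b} a≤1+b none with m≤n⇒m<n∨m≡n a≤1+b
... | inj₂ refl  = refl
... | inj₁ a<1+b = trans
  (noPrimeIn⇒π-≡ (≤-pred a<1+b) (λ k a<k k≤b → none k a<k (m≤n⇒m≤1+n k≤b)))
  (sym (π-suc-¬prime (none (suc b) a<1+b ≤-refl)))

π-≡⇔noPrimeIn : ∀ {a b} → a ≤ b → π a ≡ π b ⇔ NoPrimeIn a b
π-≡⇔noPrimeIn a≤b = mk⇔
  (λ πa≡πb k a<k k≤b p → <-irrefl πa≡πb (π-<-prime p a<k k≤b))
  (noPrimeIn⇒π-≡ a≤b)

*≤⇔≤/ : ∀ {m o} n .{{_ : NonZero n}} → m * n ≤ o ⇔ m ≤ o / n
*≤⇔≤/ {m} {o} n = mk⇔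
  (λ mn≤o → ≤-trans (≤-reflexive (sym (m*n/n≡m m n))) (/-monoˡ-≤ n mn≤o))
  (λ m≤o/n → ≤-trans (*-monoˡ-≤ n m≤o/n) (m/n*n≤m o n))

<*⇔/< : ∀ {m k} n .{{_ : NonZero n}} → m < k * n ⇔ m / n < k
<*⇔/< n = mk⇔ m<n*o⇒m/o<n
  (λ m/n<k → ≰⇒> λ kn≤m → <⇒≱ m/n<k (Equivalence.to (*≤⇔≤/ n) kn≤m))

double≢prime : ∀ {q} → Prime q → q ≢ 2 → ∀ k → k * 2 ≢ q
double≢prime pq q≢2 k k*2≡q with prime⇒irreducible pq (divides k (sym k*2≡q))
... | inj₁ ()
... | inj₂ 2≡q = q≢2 (sym 2≡q)

HalfIntervalComposite : ℕ → ℕ → Set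
HalfIntervalComposite p q = ∀ k → p + 1 ≤ 2 * k → 2 * k + 1 ≤ q → Composite k

lower-half : ∀ p k → p + 1 ≤ 2 * k ⇔ p / 2 < k
lower-half p k = ⇔-trans
  (mk⇔ (subst₂ _≤_ (+-comm p 1) (*-comm 2 k)) (subst₂ _≤_ (+-comm 1 p) (*-comm k 2)))
  (<*⇔/< 2)

upper-half : ∀ {q} → Prime q → q ≢ 2 → ∀ k → 2 * k + 1 ≤ q ⇔ k ≤ q / 2
upper-half {q} pq q≢2 k = mk⇔
  (λ 2k+1≤q → Equivalence.to (*≤⇔≤/ 2) (subst (_≤ q) (*-comm 2 k) (m+n≤o⇒m≤o (2 * k) 2k+1≤q)))
  (λ k≤q/2 → subst (_≤ q) (+-comm 1 (2 * k))
    (subst (λ x → suc x ≤ q) (*-comm k 2)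
      (≤∧≢⇒< (Equivalence.from (*≤⇔≤/ 2) k≤q/2) (double≢prime pq q≢2 k))))

halfIntervalComposite⇔noPrimeIn : ∀ {p q} → 2 ≤ p → Prime q → 2 < q →
  HalfIntervalComposite p q ⇔ NoPrimeIn (p / 2) (q / 2)
halfIntervalComposite⇔noPrimeIn {p} {q} 2≤p pq 2<q = mk⇔
  (λ allComposite k p/2<k k≤q/2 →
    composite⇒¬prime (allComposite k (from (lower-half p k) p/2<k) (from (upper k) k≤q/2)))
  (λ none k p+1≤2k 2k+1≤q →
    let p/2<k = to (lower-half p k) p+1≤2k
        1<k   = ≤-<-trans (/-monoˡ-≤ 2 2≤p) p/2<k
    in ¬prime⇒composite {{n>1⇒nonTrivial 1<k}} (none k p/2<k (to (upper k) 2k+1≤q)))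
  where
  open Equivalence
  upper : ∀ k → 2 * k + 1 ≤ q ⇔ k ≤ q / 2
  upper = upper-half pq (>⇒≢ 2<q)

isRPrime⇔halfIntervalComposite : ∀ {n p q} → 2 ≤ n →
  IsRPrime n p q ⇔ HalfIntervalComposite p q
isRPrime⇔halfIntervalComposite 2≤n = mk⇔
  (λ { (inj₁ refl) → contradiction 2≤n (<-irrefl refl) ; (inj₂ (_ , allComposite)) → allComposite })
  (λ allComposite → inj₂ (2≤n , allComposite))

nthPrime-< : ∀ {n p q} → IsNthPrime n p → IsNthPrime (suc n) q → p < q
nthPrime-< {n} (_ , πp≡n) (_ , πq≡1+n) = π-<⇒< (subst₂ _<_ (sym πp≡n) (sym πq≡1+n) (n<1+n n))

nextPrime-minimal : ∀ {n p q k} → IsNthPrime n p → IsNthPrime (suc n) q →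
  Prime k → p < k → q ≤ k
nextPrime-minimal {k = k} (_ , πp≡n) (pq , πq≡1+n) pk p<k = ≮⇒≥ λ k<q →
  <⇒≱ (π-<-prime pk p<k ≤-refl)
      (≤-pred (subst (π k <_) (trans πq≡1+n (cong suc (sym πp≡n))) (π-<-prime pq k<q ≤-refl)))

prime-after-2 : ∀ {n q} → IsNthPrime n 2 → IsNthPrime (suc n) q → q ≡ 3
prime-after-2 pth qth =
  ≤-antisym (nextPrime-minimal pth qth (toWitness {a? = prime? 3} _) ≤-refl) (nthPrime-< pth qth)

proposition2 : ∀ (n p q : ℕ) → 1 ≤ n → IsNthPrime n p → IsNthPrime (suc n) q →
    (IsRPrime n p q ⇔ (π (p / 2) ≡ π (q / 2)))
proposition2 n p q _ pth@(pp , πp≡n) qth@(pq , _)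
  with m≤n⇒m<n∨m≡n (nonTrivial⇒n>1 p {{prime⇒nonTrivial pp}})
... | inj₂ refl rewrite prime-after-2 pth qth = mk⇔ (λ _ → refl) (λ _ → inj₁ (sym πp≡n))
... | inj₁ 2<p =
  ⇔-trans (isRPrime⇔halfIntervalComposite 2≤n)
    (⇔-trans (halfIntervalComposite⇔noPrimeIn (<⇒≤ 2<p) pq (<-trans 2<p p<q))
      (⇔-sym (π-≡⇔noPrimeIn (/-monoˡ-≤ 2 (<⇒≤ p<q)))))
  where
  p<q : p < q
  p<q = nthPrime-< pth qth
  2≤n : 2 ≤ n
  2≤n = subst (2 ≤_) πp≡n (π-<-prime {2} pp 2<p ≤-refl)
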